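{- Let $d\ge 1$ and let $K$ be a triangulation of the $d$-simplex $\Delta^d$. Then the graph $G_K$ is not $(d+1)$-colourable if and only if every Sperner labelling of $K$ has a rainbow facet.
   Context: A triangulation of the $d$-simplex $\Delta^d$ (with vertices $v_1,\dots,v_{d+1}$) is a finite geometric simplicial complex $K$ whose union of simplices is $\Delta^d$; the vertices $v_1,\dots,v_{d+1}$ are vertices of $K$. Facets of $K$ are its $d$-simplices. A Sperner labelling of $K$ is a map $\lambda: V(K)\to\{1,\dots,d+1\}$ with $\lambda(v_i)=i$ for all $i$ such that every vertex of $K$ lying in a face of $\Delta^d$ has the same label as one of the vertices of that face. A simplex is rainbow if its vertices receive pairwise distinct labels. The graph $G_K$ has vertex set consisting of: (V1) the vertices $u_1,\dots,u_n$ of $K$; (V2) a vertex $v_\rho$ for each $d$-simplex $\rho$ of $K$; (V3) a vertex $w_\tau$ for each $(d-1)$-dimensional face $\tau$ of $\Delta^d$. Its edges are: $u_iv_\rho$ whenever $u_i$ is a vertex of $\rho$; $u_iw_\tau$ whenever $u_i$ lies in the $(d-1)$-face $\tau$ of $\Delta^d$; and $w_\tau w_{\tau'}$ for every pair of distinct $(d-1)$-faces $\tau,\tau'$ of $\Delta^d$. A $k$-colouring of a graph is a map $c:V\to\{1,\dots,k\}$ with $c(u)\ne c(v)$ for every edge $uv$. -}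

module Defs where

open import Data.Nat using (ℕ; zero; suc)
open import Data.Fin using (Fin; zero; suc)
open import Data.Fin.Subset using (Subset; _∈_; _∉_)
open import Data.Product using (Σ; ∃; ∃-syntax; _×_; _,_)
open import Relation.Binary.PropositionalEquality using (_≡_; _≢_)
open import Relation.Binary.Structures using (IsTotalOrder)
open import Algebra.Structures using (IsCommutativeRing)
open import Relation.Nullary using (¬_)

-- Ordered fields (the scalars of the ambient space; ℝ is one instance).

record OrderedField : Set₁ where
  infixl 6 _+_
  infixl 7 _*_
  infix 4 _≤_
  field
    Carrier : Set
    _+_ _*_ : Carrier → Carrier → Carrier
    -_      : Carrier → Carrier
    0# 1#   : Carrier
    _≤_     : Carrier → Carrier → Set
    isCommutativeRing : IsCommutativeRing _≡_ _+_ _*_ -_ 0# 1#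
    0≢1     : 0# ≢ 1#
    inverse : ∀ x → x ≢ 0# → ∃[ y ] (x * y ≡ 1#)
    isTotalOrder : IsTotalOrder _≡_ _≤_
    +-mono-≤ : ∀ x y z → x ≤ y → x + z ≤ y + z
    *-nonneg : ∀ x y → 0# ≤ x → 0# ≤ y → 0# ≤ x * y

module _ (F : OrderedField) where
  open OrderedField F

  ∑ : ∀ {k} → (Fin k → Carrier) → Carrier
  ∑ {zero}  t = 0#
  ∑ {suc k} t = t zero + ∑ (λ i → t (suc i))

  -- points of F^{d+1}; Δ^d is realised by barycentric coordinates
  Point : ℕ → Set
  Point d = Fin (suc d) → Carrier

  InΔ : ∀ {d} → Point d → Set
  InΔ p = (∀ i → 0# ≤ p i) × (∑ p ≡ 1#)

  e : ∀ {d} → Fin (suc d) → Point d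
  e i j with i Data.Fin.≟ j
  ... | Relation.Nullary.yes _ = 1#
  ... | Relation.Nullary.no _ = 0#

  _≐_ : ∀ {d} → Point d → Point d → Set
  p ≐ q = ∀ j → p j ≡ q j

  IsConvComb : ∀ {d} → (Fin (suc d) → Point d) → (Fin (suc d) → Carrier) → Point d → Set
  IsConvComb q t x = (∀ a → 0# ≤ t a) × (∑ t ≡ 1#) × (∀ j → x j ≡ ∑ (λ a → t a * q a j))

  AffInd : ∀ {d} → (Fin (suc d) → Point d) → Set
  AffInd q = ∀ (t : Fin (suc _) → Carrier) → ∑ t ≡ 0#
           → (∀ j → ∑ (λ a → t a * q a j) ≡ 0#) → ∀ a → t a ≡ 0#

  -- A triangulation K of Δ^d: vertices u : Fin n placed at pos u,
  -- facets (d-simplices) ρ : Fin m with vertices facet ρ 0, …, facet ρ d.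
  -- K is the complex of all faces of the facets.

  record Triangulation (d : ℕ) : Set where
    field
      n m   : ℕ
      pos   : Fin n → Point d
      facet : Fin m → Fin (suc d) → Fin n
    _∈F_ : Fin n → Fin m → Set
    u ∈F ρ = ∃[ a ] (facet ρ a ≡ u)
    field
      pos-inj   : ∀ u u' → pos u ≐ pos u' → u ≡ u'
      pos-in-Δ  : ∀ u → InΔ (pos u)
      facet-inj : ∀ ρ a b → facet ρ a ≡ facet ρ b → a ≡ b
      facet-ind : ∀ ρ → AffInd (λ a → pos (facet ρ a))
      facets-distinct : ∀ ρ σ → (∀ u → (u ∈F ρ → u ∈F σ) × (u ∈F σ → u ∈F ρ)) → ρ ≡ σ
      vertex-in-facet : ∀ u → ∃[ ρ ] (u ∈F ρ)
      -- simplicial complex: conv ρ ∩ conv σ = conv(ρ ∩ σ)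
      -- (equivalently: any two simplices of K meet in a common face)
      intersect : ∀ ρ σ x s t → IsConvComb (λ a → pos (facet ρ a)) s x
                  → IsConvComb (λ a → pos (facet σ a)) t x
                  → ∃[ r ] (IsConvComb (λ a → pos (facet ρ a)) r x
                            × (∀ a → r a ≢ 0# → facet ρ a ∈F σ))
      cover : ∀ x → InΔ {d} x → ∃[ ρ ] ∃[ t ] IsConvComb (λ a → pos (facet ρ a)) t x
      corners : ∀ i → ∃[ u ] (pos u ≐ e i)

  module _ {d : ℕ} (K : Triangulation d) where
    open Triangulation K

    InFace : Fin n → Subset (suc d) → Set
    InFace u S = ∀ j → j ∉ S → pos u j ≡ 0#

    InFacet : Fin n → Fin (suc d) → Set
    InFacet u i = pos u i ≡ 0#

    SpernerLabelling : (Fin n → Fin (suc d)) → Set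
    SpernerLabelling λ' = (∀ i u → pos u ≐ e i → λ' u ≡ i)
                        × (∀ u S → InFace u S → λ' u ∈ S)

    Rainbow : (Fin n → Fin (suc d)) → Fin m → Set
    Rainbow λ' ρ = ∀ a b → λ' (facet ρ a) ≡ λ' (facet ρ b) → a ≡ b

    data GV : Set where
      U : Fin n → GV
      V : Fin m → GV
      W : Fin (suc d) → GV    -- (V3) W i = w_{τ_i}, τ_i the face opposite v_i

    data GE : GV → GV → Set where
      uv : ∀ u ρ → u ∈F ρ → GE (U u) (V ρ)
      uw : ∀ u i → InFacet u i → GE (U u) (W i)
      ww : ∀ i j → i ≢ j → GE (W i) (W j)

    Colouring : ℕ → Set
    Colouring k = Σ (GV → Fin k) (λ c → ∀ x y → GE x y → c x ≢ c y)

    Colourable : ℕ → Set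
    Colourable k = Colouring k

{-# OPTIONS --safe #-}
module Submission where

-- A proper (d+1)-colouring c of G_K and a Sperner labelling without a rainbow facet are two
-- views of the same object. The clique on the w_τ uses every colour once, so the colour of
-- w_{τ_i} may be renamed to i; an edge u w_{τ_i} then says exactly that u is not labelled i
-- when u lies on τ_i, which is the Sperner condition. An edge u v_ρ says that the colour of
-- v_ρ is missing among the labels of ρ; with d+1 labels on d+1 vertices, a facet misses a
-- label precisely when it is not rainbow.

open import Defs
open import Data.Nat using (ℕ; suc; _≤_)
open import Data.Nat.Properties using (1+n≰n)
open import Data.Fin using (Fin; punchOut; _≟_)
open import Data.Fin.Properties using (any?; all?; ¬∀⟶∃¬; punchOut-injective; injective⇒≤)
open import Data.Fin.Subset using (_∈_; ⁅_⁆; ∁)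
open import Data.Fin.Subset.Properties
  using (_∈?_; x∈⁅x⁆; x∈⁅y⁆⇒x≡y; x∉⁅y⁆⇒x≢y; x∈∁p⇒x∉p; x∉∁p⇒x∈p)
open import Data.Product using (∃; ∃-syntax; _,_; proj₁; proj₂; uncurry)
open import Data.Empty using (⊥-elim)
open import Function.Base using (_∘_)
open import Function.Bundles using (_⇔_; mk⇔; module Equivalence)
open import Function.Definitions using (Injective)
open import Relation.Nullary using (¬_; yes; no; contradiction)
open import Relation.Nullary.Decidable using (Dec; _→-dec_)
open import Relation.Binary.PropositionalEquality using (_≡_; _≢_; refl; sym; trans; cong; subst)
open Relation.Binary.PropositionalEquality.≡-Reasoning

injective⇒surjective : ∀ {k} {f : Fin k → Fin k} → Injective _≡_ _≡_ f → ∀ y → ∃ λ x → f x ≡ y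
injective⇒surjective {suc k} {f} f-inj y with any? (λ x → f x ≟ y)
... | yes hit = hit
... | no ¬hit = contradiction (injective⇒≤ g-inj) 1+n≰n
  where
  f≢y : ∀ x → f x ≢ y
  f≢y x fx≡y = ¬hit (x , fx≡y)

  g : Fin (suc k) → Fin k
  g x = punchOut (f≢y x ∘ sym)

  g-inj : Injective _≡_ _≡_ g
  g-inj {x} {x'} = f-inj ∘ punchOut-injective (f≢y x ∘ sym) (f≢y x' ∘ sym)

surjective⇒injective : ∀ {k} {f : Fin k → Fin k} → (∀ y → ∃ λ x → f x ≡ y) → Injective _≡_ _≡_ f
surjective⇒injective {k} {f} f-surj {a} {b} fa≡fb = begin
  a       ≡⟨ sym (gf a) ⟩
  g (f a) ≡⟨ cong g fa≡fb ⟩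
  g (f b) ≡⟨ gf b ⟩
  b       ∎
  where
  g : Fin k → Fin k
  g = proj₁ ∘ f-surj

  fg : ∀ y → f (g y) ≡ y
  fg = proj₂ ∘ f-surj

  g-inj : Injective _≡_ _≡_ g
  g-inj {y} {y'} gy≡gy' = trans (sym (fg y)) (trans (cong f gy≡gy') (fg y'))

  gf : ∀ x → g (f x) ≡ x
  gf x with injective⇒surjective g-inj x
  ... | x' , refl = cong g (fg x')

¬injective⇒∃missed : ∀ {k} {f : Fin k → Fin k} → ¬ Injective _≡_ _≡_ f → ∃ λ y → ∀ x → f x ≢ y
¬injective⇒∃missed {k} {f} ¬inj with all? (λ y → any? (λ x → f x ≟ y))
... | yes f-surj = ⊥-elim (¬inj (surjective⇒injective f-surj))
... | no ¬f-surj with y , ¬hit ← ¬∀⟶∃¬ k _ (λ y → any? (λ x → f x ≟ y)) ¬f-surj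
  = y , λ x fx≡y → ¬hit (x , fx≡y)

e-offDiagonal : (F : OrderedField) {d : ℕ} {i j : Fin (suc d)} → i ≢ j → e F i j ≡ OrderedField.0# F
e-offDiagonal F {i = i} {j} i≢j with i ≟ j
... | yes i≡j = contradiction i≡j i≢j
... | no _    = refl

module _ (F : OrderedField) {d : ℕ} (K : Triangulation F d) where
  open OrderedField F using (0#)
  open Triangulation K

  AvoidsOppositeFacets : (Fin n → Fin (suc d)) → Set
  AvoidsOppositeFacets λ' = ∀ u i → InFacet F K u i → λ' u ≢ i

  SpernerLabelling⇔AvoidsOppositeFacets : ∀ λ' → SpernerLabelling F K λ' ⇔ AvoidsOppositeFacets λ'
  SpernerLabelling⇔AvoidsOppositeFacets λ' = mk⇔ avoids sperner
    where
    avoids : SpernerLabelling F K λ' → AvoidsOppositeFacets λ'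
    avoids (_ , inFace) u i uᵢ≡0 λ'u≡i =
      x∈∁p⇒x∉p (inFace u (∁ ⁅ i ⁆) u∈τᵢ) (subst (_∈ ⁅ i ⁆) (sym λ'u≡i) (x∈⁅x⁆ i))
      where
      u∈τᵢ : InFace F K u (∁ ⁅ i ⁆)
      u∈τᵢ j j∉∁⁅i⁆ = subst (λ j → pos u j ≡ 0#) (sym (x∈⁅y⁆⇒x≡y i (x∉∁p⇒x∈p j∉∁⁅i⁆))) uᵢ≡0

    sperner : AvoidsOppositeFacets λ' → SpernerLabelling F K λ'
    sperner avoid = corner , inFace
      where
      inFace : ∀ u S → InFace F K u S → λ' u ∈ S
      inFace u S u∈S with λ' u ∈? S
      ... | yes λ'u∈S = λ'u∈S
      ... | no λ'u∉S  = contradiction refl (avoid u (λ' u) (u∈S (λ' u) λ'u∉S))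

      corner : ∀ i u → _≐_ F (pos u) (e F i) → λ' u ≡ i
      corner i u u≐vᵢ = x∈⁅y⁆⇒x≡y i (inFace u ⁅ i ⁆ λ j j∉⁅i⁆ →
        trans (u≐vᵢ j) (e-offDiagonal F (x∉⁅y⁆⇒x≢y j∉⁅i⁆ ∘ sym)))

  rainbow? : ∀ λ' ρ → Dec (Rainbow F K λ' ρ)
  rainbow? λ' ρ = all? λ a → all? λ b → (λ' (facet ρ a) ≟ λ' (facet ρ b)) →-dec (a ≟ b)

  labelling⇒colouring : ∀ λ' → AvoidsOppositeFacets λ' → (∀ ρ → ¬ Rainbow F K λ' ρ)
    → Colouring F K (suc d)
  labelling⇒colouring λ' avoid ¬rainbow = c , proper
    where
    missed : ∀ ρ → ∃ λ i → ∀ a → λ' (facet ρ a) ≢ i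
    missed ρ = ¬injective⇒∃missed (λ inj → ¬rainbow ρ (λ a b → inj))

    c : GV F K → Fin (suc d)
    c (U u) = λ' u
    c (V ρ) = proj₁ (missed ρ)
    c (W i) = i

    proper : ∀ x y → GE F K x y → c x ≢ c y
    proper _ _ (uv u ρ (a , refl)) = proj₂ (missed ρ) a
    proper _ _ (uw u i uᵢ≡0)       = avoid u i uᵢ≡0
    proper _ _ (ww i j i≢j)        = i≢j

  module ColouringLabels (c : GV F K → Fin (suc d)) (proper : ∀ x y → GE F K x y → c x ≢ c y) where

    c∘W-injective : Injective _≡_ _≡_ (c ∘ W)
    c∘W-injective {i} {j} cᵢ≡cⱼ with i ≟ j
    ... | yes i≡j = i≡j
    ... | no i≢j  = contradiction cᵢ≡cⱼ (proper (W i) (W j) (ww i j i≢j))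

    label : Fin n → Fin (suc d)
    label u = proj₁ (injective⇒surjective c∘W-injective (c (U u)))

    c-label : ∀ u → c (W (label u)) ≡ c (U u)
    c-label u = proj₂ (injective⇒surjective c∘W-injective (c (U u)))

    label-avoidsOppositeFacets : AvoidsOppositeFacets label
    label-avoidsOppositeFacets u i uᵢ≡0 refl = proper (U u) (W i) (uw u i uᵢ≡0) (sym (c-label u))

    label-sperner : SpernerLabelling F K label
    label-sperner = Equivalence.from (SpernerLabelling⇔AvoidsOppositeFacets label) label-avoidsOppositeFacets

    ¬rainbow : ∀ ρ → ¬ Rainbow F K label ρ
    ¬rainbow ρ rainbow
      with k , cₖ≡cᵨ ← injective⇒surjective c∘W-injective (c (V ρ))
      with a , labelₐ≡k ← injective⇒surjective (λ {a} {b} → rainbow a b) k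
      = proper (U (facet ρ a)) (V ρ) (uv (facet ρ a) ρ (a , refl)) (begin
        c (U (facet ρ a))         ≡⟨ sym (c-label (facet ρ a)) ⟩
        c (W (label (facet ρ a))) ≡⟨ cong (c ∘ W) labelₐ≡k ⟩
        c (W k)                   ≡⟨ cₖ≡cᵨ ⟩
        c (V ρ)                   ∎)

proposition3p1 : (F : OrderedField) (d : ℕ) → 1 ≤ d → (K : Triangulation F d)
    → (¬ Colourable F K (suc d))
      ⇔ (∀ (λ' : Fin (Triangulation.n K) → Fin (suc d)) → SpernerLabelling F K λ'
          → ∃[ ρ ] Rainbow F K λ' ρ)
proposition3p1 F d _ K = mk⇔ forward backward
  where
  forward : ¬ Colourable F K (suc d) → ∀ λ' → SpernerLabelling F K λ' → ∃[ ρ ] Rainbow F K λ' ρ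
  forward ¬colourable λ' sperner with any? (rainbow? F K λ')
  ... | yes rainbow = rainbow
  ... | no ¬rainbow = ⊥-elim (¬colourable (labelling⇒colouring F K λ'
          (Equivalence.to (SpernerLabelling⇔AvoidsOppositeFacets F K λ') sperner)
          (λ ρ r → ¬rainbow (ρ , r))))

  backward : (∀ λ' → SpernerLabelling F K λ' → ∃[ ρ ] Rainbow F K λ' ρ) → ¬ Colourable F K (suc d)
  backward allRainbow (c , proper) = uncurry ¬rainbow (allRainbow label label-sperner)
    where open ColouringLabels F K c proper
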